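{- Let $n\ge1$, $N=\{1,\dots,n\}$, and let $0\le p_1\le p_2\le\dots\le p_n$ and $0\le q_1\le q_2\le\dots\le q_n$. For a permutation $\pi$ of $N$, consider the instance in which job $j$ has first-stage processing time $p_j$ and second-stage processing time $q_{\pi(j)}$, and define \[ UB(\pi)=\min_{\sigma}\sum_{i\in N}(n+1-i)\big(p_{\sigma(i)}+q_{\pi(\sigma(i))}\big),\qquad LB=\sum_{i\in N}(n+1-i)(p_i+q_i), \] where the minimum is over all permutations $\sigma$ of $N$. Let $\pi'$ be the permutation $\pi'(j)=n+1-j$. Then, whenever $LB>0$, \[ \frac{UB(\pi)}{LB}\le\frac{UB(\pi')}{LB}. \]
   Context: $UB(\pi)$ is the optimal value of the problem of scheduling the jobs in a single order used in both stages (sum of first-stage plus second-stage completion times), and $LB$ is the sum of the optimal first-stage and optimal second-stage total completion times computed independently (which does not depend on $\pi$).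
   Formalization: The first-stage and second-stage processing times are rational rather than real numbers. -}

module Defs where

open import Data.Nat using (ℕ; zero; suc; _∸_)
open import Data.Fin using (Fin; zero; suc; toℕ)
open import Data.Fin.Permutation using (Permutation′; _⟨$⟩ʳ_)
open import Data.Integer using (+_)
open import Data.Rational using (ℚ; 0ℚ; _+_; _*_; _/_; _≤_)
open import Data.Product using (_×_; ∃)
open import Relation.Binary.PropositionalEquality using (_≡_)

sumF : (n : ℕ) → (Fin n → ℚ) → ℚ
sumF zero    f = 0ℚ
sumF (suc n) f = f zero + sumF n (λ i → f (suc i))

-- weight (n+1-i) for the 1-based position i; with 0-based k = i-1 this is n - k
weight : (n : ℕ) → Fin n → ℚ
weight n k = (+ (n ∸ toℕ k)) / 1

cost : (n : ℕ) → (p q : Fin n → ℚ) → (π : Fin n → Fin n) → Permutation′ n → ℚ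
cost n p q π σ = sumF n (λ i → weight n i * (p (σ ⟨$⟩ʳ i) + q (π (σ ⟨$⟩ʳ i))))

IsUB : (n : ℕ) → (p q : Fin n → ℚ) → (π : Fin n → Fin n) → ℚ → Set
IsUB n p q π u = (∃ λ σ → cost n p q π σ ≡ u) × (∀ σ → u ≤ cost n p q π σ)

LB : (n : ℕ) → (p q : Fin n → ℚ) → ℚ
LB n p q = sumF n (λ i → weight n i * (p i + q i))

{-# OPTIONS --safe #-}
-- Write f ≼ g when every schedule under the second-stage assignment g is matched by some
-- schedule under f that costs no more, so that UB(f) ≤ UB(g). Exchanging the second-stage
-- times of two jobs j, l with p j ≤ p l and q (f j) ≤ q (f l) can only make things worse:
-- if j is scheduled first, the two-term rearrangement inequality on the weights shows the old
-- assignment is no worse on the same schedule; if l comes first, the same inequality applies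
-- after also exchanging j and l in the schedule. Fixing the positions 0, 1, … one at a time,
-- such exchanges turn π into the reversal, so UB(π) ≤ UB(reversal); dividing by LB > 0 gives
-- the claim.
module Submission where

open import Defs
open import Data.Nat using (ℕ; _≥_)
open import Data.Fin using (Fin; opposite)
open import Data.Fin.Permutation using (Permutation′; _⟨$⟩ʳ_)
open import Data.Rational using (ℚ; 0ℚ; _≤_; _<_; _÷_; positive)
open import Data.Rational.Properties using (pos⇒nonZero)

import Data.Nat as ℕ
import Data.Nat.Properties as ℕ
open import Data.Nat.Divisibility using (∣1⇒≡1)
import Data.Fin as F
import Data.Fin.Properties as F
open import Data.Fin.Permutation using (_⟨$⟩ˡ_; inverseˡ; inverseʳ; _∘ₚ_; transpose)
import Data.Fin.Permutation.Components as PC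
import Data.Integer as ℤ
import Data.Integer.Properties as ℤ
open import Data.Rational using (_+_; _*_; _-_; -_; mkℚ; *≤*; 1/_; Positive; nonNegative)
import Data.Rational.Properties as ℚ
open import Data.Rational.Solver using (module +-*-Solver)
open +-*-Solver using (solve; _:=_; _:+_; _:*_; _:-_)
open import Data.Product using (∃; _×_; _,_; proj₂)
open import Data.Sum using (inj₁; inj₂)
open import Function using (_∘′_)
open import Function.Bundles using (Injection)
open import Function.Properties.Inverse using (↔⇒↣)
open import Relation.Nullary using (yes; no; contradiction)
open import Relation.Binary.Definitions using (tri<; tri≈; tri>)
open import Relation.Binary.PropositionalEquality

transpose-matchˡ : ∀ {n} (i j : Fin n) → PC.transpose i j i ≡ j
transpose-matchˡ i j with i F.≟ i
... | yes _  = refl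
... | no i≢i = contradiction refl i≢i

transpose-matchʳ : ∀ {n} (i j : Fin n) → PC.transpose i j j ≡ i
transpose-matchʳ i j with j F.≟ i
... | yes j≡i = j≡i
... | no _ with j F.≟ j
...   | yes _  = refl
...   | no j≢j = contradiction refl j≢j

transpose-other : ∀ {n} {i j k : Fin n} → k ≢ i → k ≢ j → PC.transpose i j k ≡ k
transpose-other {i = i} {j} {k} k≢i k≢j with k F.≟ i
... | yes k≡i = contradiction k≡i k≢i
... | no _ with k F.≟ j
...   | yes k≡j = contradiction k≡j k≢j
...   | no _    = refl

⟨$⟩ʳ-injective : ∀ {n} (π : Permutation′ n) {i j} → π ⟨$⟩ʳ i ≡ π ⟨$⟩ʳ j → i ≡ j
⟨$⟩ʳ-injective π = Injection.injective (↔⇒↣ π)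

opposite-antimono-< : ∀ {n} {i j : Fin n} → i F.< j → opposite j F.< opposite i
opposite-antimono-< {i = i} {j} i<j =
  subst₂ ℕ._<_ (sym (F.opposite-prop j)) (sym (F.opposite-prop i))
    (ℕ.∸-monoʳ-< (ℕ.s≤s i<j) (F.toℕ<n j))

+-cancelʳ-≤ : ∀ {x y} c → x + c ≤ y + c → x ≤ y
+-cancelʳ-≤ {x} {y} c x+c≤y+c =
  subst₂ _≤_ (+-∸ x) (+-∸ y) (ℚ.+-monoˡ-≤ (- c) x+c≤y+c)
  where
  +-∸ : ∀ z → (z + c) - c ≡ z
  +-∸ z = solve 2 (λ z c → (z :+ c) :- c := z) refl z c

rearrangement₂ : ∀ {w₁ w₂ x y} → w₂ ≤ w₁ → x ≤ y → w₁ * x + w₂ * y ≤ w₁ * y + w₂ * x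
rearrangement₂ {w₁} {w₂} {x} {y} w₂≤w₁ x≤y =
  subst₂ _≤_ (sym lhs≡) (sym rhs≡) (ℚ.+-monoʳ-≤ (w₁ * x + w₂ * x) w₂δ≤w₁δ)
  where
  0≤y-x : 0ℚ ≤ y - x
  0≤y-x = subst (_≤ y - x) (ℚ.+-inverseʳ x) (ℚ.+-monoˡ-≤ (- x) x≤y)
  w₂δ≤w₁δ : w₂ * (y - x) ≤ w₁ * (y - x)
  w₂δ≤w₁δ = ℚ.*-monoʳ-≤-nonNeg (y - x) {{nonNegative 0≤y-x}} w₂≤w₁
  lhs≡ : w₁ * x + w₂ * y ≡ (w₁ * x + w₂ * x) + w₂ * (y - x)
  lhs≡ = solve 4 (λ w₁ w₂ x y → w₁ :* x :+ w₂ :* y := (w₁ :* x :+ w₂ :* x) :+ w₂ :* (y :- x))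
    refl w₁ w₂ x y
  rhs≡ : w₁ * y + w₂ * x ≡ (w₁ * x + w₂ * x) + w₁ * (y - x)
  rhs≡ = solve 4 (λ w₁ w₂ x y → w₁ :* y :+ w₂ :* x := (w₁ :* x :+ w₂ :* x) :+ w₁ :* (y :- x))
    refl w₁ w₂ x y

exchangeʳ : ∀ {w₁ w₂ x y} c d → w₂ ≤ w₁ → x ≤ y →
            w₁ * (c + x) + w₂ * (d + y) ≤ w₁ * (c + y) + w₂ * (d + x)
exchangeʳ {w₁} {w₂} {x} {y} c d w₂≤w₁ x≤y =
  subst₂ _≤_ (sym (regroup x y)) (sym (regroup y x))
    (ℚ.+-monoʳ-≤ (w₁ * c + w₂ * d) (rearrangement₂ w₂≤w₁ x≤y))
  where
  regroup : ∀ s t → w₁ * (c + s) + w₂ * (d + t) ≡ (w₁ * c + w₂ * d) + (w₁ * s + w₂ * t)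
  regroup s t = solve 6 (λ w₁ w₂ c d s t →
    w₁ :* (c :+ s) :+ w₂ :* (d :+ t) := (w₁ :* c :+ w₂ :* d) :+ (w₁ :* s :+ w₂ :* t))
    refl w₁ w₂ c d s t

exchangeˡ : ∀ {w₁ w₂ x y} c d → w₂ ≤ w₁ → x ≤ y →
            w₁ * (x + c) + w₂ * (y + d) ≤ w₁ * (y + c) + w₂ * (x + d)
exchangeˡ {w₁} {w₂} {x} {y} c d w₂≤w₁ x≤y =
  subst₂ _≤_ (commute x y) (commute y x) (exchangeʳ c d w₂≤w₁ x≤y)
  where
  commute : ∀ s t → w₁ * (c + s) + w₂ * (d + t) ≡ w₁ * (s + c) + w₂ * (t + d)
  commute s t = cong₂ (λ u v → w₁ * u + w₂ * v) (ℚ.+-comm c s) (ℚ.+-comm d t)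

weight-antitone : ∀ n {a b : Fin n} → a F.≤ b → weight n b ≤ weight n a
weight-antitone n {a} {b} a≤b = subst₂ _≤_ (sym (ℕ/1≡ (n ℕ.∸ F.toℕ b))) (sym (ℕ/1≡ (n ℕ.∸ F.toℕ a)))
  (*≤* (subst₂ ℤ._≤_ (sym (ℤ.*-identityʳ _)) (sym (ℤ.*-identityʳ _)) (ℤ.+≤+ (ℕ.∸-monoʳ-≤ n a≤b))))
  where
  -- (+ k) / 1 is stuck for a variable k: normalisation computes a gcd.
  ℕ/1≡ : ∀ k → ℤ.+ k Data.Rational./ 1 ≡ mkℚ (ℤ.+ k) 0 (λ {d} cd → ∣1⇒≡1 (proj₂ cd))
  ℕ/1≡ k = ℚ.normalize-coprime {k} {0} (λ {d} cd → ∣1⇒≡1 (proj₂ cd))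

÷-monoˡ-≤-pos : ∀ {x y} r .{{_ : Positive r}} → x ≤ y →
                (x ÷ r) {{pos⇒nonZero r}} ≤ (y ÷ r) {{pos⇒nonZero r}}
÷-monoˡ-≤-pos r x≤y = ℚ.*-monoʳ-≤-nonNeg 1/r {{ℚ.pos⇒nonNeg 1/r {{ℚ.1/pos⇒pos r}}}} x≤y
  where
  1/r : ℚ
  1/r = (1/ r) {{pos⇒nonZero r}}

sumF-cong : ∀ m {F G : Fin m → ℚ} → (∀ i → F i ≡ G i) → sumF m F ≡ sumF m G
sumF-cong ℕ.zero    F≗G = refl
sumF-cong (ℕ.suc m) F≗G = cong₂ _+_ (F≗G F.zero) (sumF-cong m (λ i → F≗G (F.suc i)))

sumF-update : ∀ m {F G : Fin m → ℚ} (a : Fin m) → (∀ i → i ≢ a → F i ≡ G i) →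
              sumF m F + G a ≡ sumF m G + F a
sumF-update (ℕ.suc m) {F} {G} F.zero F≗G =
  trans (cong (λ s → F F.zero + s + G F.zero) (sumF-cong m (λ i → F≗G (F.suc i) λ ())))
        (solve 3 (λ f s g → f :+ s :+ g := g :+ s :+ f) refl
          (F F.zero) (sumF m (G ∘′ F.suc)) (G F.zero))
sumF-update (ℕ.suc m) {F} {G} (F.suc a) F≗G = begin
  F F.zero + sumF m (F ∘′ F.suc) + G (F.suc a)   ≡⟨ ℚ.+-assoc (F F.zero) _ _ ⟩
  F F.zero + (sumF m (F ∘′ F.suc) + G (F.suc a)) ≡⟨ cong₂ _+_ (F≗G F.zero λ ()) (sumF-update m a tail-≗) ⟩
  G F.zero + (sumF m (G ∘′ F.suc) + F (F.suc a)) ≡⟨ ℚ.+-assoc (G F.zero) _ _ ⟨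
  G F.zero + sumF m (G ∘′ F.suc) + F (F.suc a)   ∎
  where
  open ≡-Reasoning
  tail-≗ : ∀ i → i ≢ a → F (F.suc i) ≡ G (F.suc i)
  tail-≗ i i≢a = F≗G (F.suc i) (i≢a ∘′ F.suc-injective)

sumF-update₂ : ∀ m {F G : Fin m → ℚ} {a b : Fin m} → a ≢ b → (∀ i → i ≢ a → i ≢ b → F i ≡ G i) →
               sumF m F + (G a + G b) ≡ sumF m G + (F a + F b)
sumF-update₂ m {F} {G} {a} {b} a≢b F≗G = begin
  sumF m F + (G a + G b)   ≡⟨ solve 3 (λ s x y → s :+ (x :+ y) := (s :+ y) :+ x) refl (sumF m F) (G a) (G b) ⟩
  (sumF m F + G b) + G a   ≡⟨ cong (λ z → (sumF m F + z) + G a) (sym H-b) ⟩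
  (sumF m F + H b) + G a   ≡⟨ cong (_+ G a) (sumF-update m b F≗H) ⟩
  (sumF m H + F b) + G a   ≡⟨ solve 3 (λ s x y → (s :+ x) :+ y := (s :+ y) :+ x) refl (sumF m H) (F b) (G a) ⟩
  (sumF m H + G a) + F b   ≡⟨ cong (_+ F b) (sumF-update m a H≗G) ⟩
  (sumF m G + H a) + F b   ≡⟨ cong (λ z → (sumF m G + z) + F b) H-a ⟩
  (sumF m G + F a) + F b   ≡⟨ ℚ.+-assoc (sumF m G) (F a) (F b) ⟩
  sumF m G + (F a + F b)   ∎
  where
  open ≡-Reasoning
  H : Fin m → ℚ
  H i with i F.≟ a
  ... | yes _ = F a
  ... | no  _ = G i
  H-a : H a ≡ F a
  H-a with a F.≟ a
  ... | yes _  = refl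
  ... | no a≢a = contradiction refl a≢a
  H-b : H b ≡ G b
  H-b with b F.≟ a
  ... | yes b≡a = contradiction (sym b≡a) a≢b
  ... | no  _   = refl
  F≗H : ∀ i → i ≢ b → F i ≡ H i
  F≗H i i≢b with i F.≟ a
  ... | yes refl = refl
  ... | no  i≢a  = F≗G i i≢a i≢b
  H≗G : ∀ i → i ≢ a → H i ≡ G i
  H≗G i i≢a with i F.≟ a
  ... | yes i≡a = contradiction i≡a i≢a
  ... | no  _   = refl

sumF-mono₂ : ∀ m {F G : Fin m → ℚ} {a b : Fin m} → a ≢ b → (∀ i → i ≢ a → i ≢ b → F i ≡ G i) →
             F a + F b ≤ G a + G b → sumF m F ≤ sumF m G
sumF-mono₂ m {F} {G} {a} {b} a≢b F≗G local = +-cancelʳ-≤ (G a + G b)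
  (subst (_≤ sumF m G + (G a + G b)) (sym (sumF-update₂ m a≢b F≗G)) (ℚ.+-monoʳ-≤ (sumF m G) local))

AgreesBelow : ∀ {n} → Permutation′ n → ℕ → Set
AgreesBelow π k = ∀ i → F.toℕ i ℕ.< k → π ⟨$⟩ʳ i ≡ opposite i

module _ {n} (π : Permutation′ n) (K : Fin n) (agree : AgreesBelow π (F.toℕ K)) where

  agreesBelow-suc : π ⟨$⟩ʳ K ≡ opposite K → AgreesBelow π (ℕ.suc (F.toℕ K))
  agreesBelow-suc πK≡ i i<1+K with ℕ.m<1+n⇒m<n∨m≡n i<1+K
  ... | inj₁ i<K = agree i i<K
  ... | inj₂ i≡K with F.toℕ-injective i≡K
  ...   | refl = πK≡

  -- The values above opposite K are the opposites of the positions below K, hence already taken.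
  agreesBelow-bound : π ⟨$⟩ʳ K F.≤ opposite K
  agreesBelow-bound = ℕ.≮⇒≥ λ oK<πK →
    let v = π ⟨$⟩ʳ K
        ov<K : opposite v F.< K
        ov<K = subst (opposite v F.<_) (F.opposite-involutive K) (opposite-antimono-< oK<πK)
        πov≡πK : π ⟨$⟩ʳ opposite v ≡ π ⟨$⟩ʳ K
        πov≡πK = trans (agree (opposite v) ov<K) (F.opposite-involutive v)
    in F.<⇒≢ ov<K (⟨$⟩ʳ-injective π πov≡πK)

module Schedules {n} (p q : Fin n → ℚ) where

  jobCost : (Fin n → Fin n) → Fin n → ℚ
  jobCost f k = p k + q (f k)

  infix 4 _≼_
  record _≼_ (f g : Fin n → Fin n) : Set where
    constructor improve
    field
      improvement : ∀ σ → ∃ λ τ → cost n p q f τ ≤ cost n p q g σ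
  open _≼_

  ≼-refl : ∀ {f} → f ≼ f
  ≼-refl = improve λ σ → σ , ℚ.≤-refl

  ≼-trans : ∀ {f g h} → f ≼ g → g ≼ h → f ≼ h
  ≼-trans f≼g g≼h = improve λ σ →
    let τ , τ≤σ = improvement g≼h σ
        υ , υ≤τ = improvement f≼g τ
    in υ , ℚ.≤-trans υ≤τ τ≤σ

  ≗⇒≼ : ∀ {f g} → (∀ k → f k ≡ g k) → f ≼ g
  ≗⇒≼ f≗g = improve λ σ → σ , ℚ.≤-reflexive (sumF-cong n λ i →
    cong (λ k → weight n i * (p (σ ⟨$⟩ʳ i) + q k)) (f≗g (σ ⟨$⟩ʳ i)))

  IsUB-mono : ∀ {f g u u′} → f ≼ g → IsUB n p q f u → IsUB n p q g u′ → u ≤ u′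
  IsUB-mono f≼g (_ , u-least) ((σ , refl) , _) =
    let τ , τ≤σ = improvement f≼g σ in ℚ.≤-trans (u-least τ) τ≤σ

  module Exchange (f : Fin n → Fin n) {j l : Fin n} (j≢l : j ≢ l)
                  (pj≤pl : p j ≤ p l) (qfj≤qfl : q (f j) ≤ q (f l)) (σ : Permutation′ n) where

    t s g : Fin n → Fin n
    t = PC.transpose j l
    s i = σ ⟨$⟩ʳ i
    g = f ∘′ t

    a b : Fin n
    a = σ ⟨$⟩ˡ j
    b = σ ⟨$⟩ˡ l

    s-a : s a ≡ j
    s-a = inverseʳ σ

    s-b : s b ≡ l
    s-b = inverseʳ σ

    a≢b : a ≢ b
    a≢b a≡b = j≢l (trans (sym s-a) (trans (cong s a≡b) s-b))

    t-fixes : ∀ i → i ≢ a → i ≢ b → t (s i) ≡ s i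
    t-fixes i i≢a i≢b = transpose-other (i≢a ∘′ position-of) (i≢b ∘′ position-of)
      where
      position-of : ∀ {k} → s i ≡ k → i ≡ σ ⟨$⟩ˡ k
      position-of sᵢ≡k = trans (sym (inverseˡ σ)) (cong (σ ⟨$⟩ˡ_) sᵢ≡k)

    g-at-a : weight n a * jobCost g (s a) ≡ weight n a * (p j + q (f l))
    g-at-a = cong (weight n a *_)
      (trans (cong (jobCost g) s-a) (cong (λ k → p j + q (f k)) (transpose-matchˡ j l)))

    g-at-b : weight n b * jobCost g (s b) ≡ weight n b * (p l + q (f j))
    g-at-b = cong (weight n b *_)
      (trans (cong (jobCost g) s-b) (cong (λ k → p l + q (f k)) (transpose-matchʳ j l)))

    j-first : a F.< b → cost n p q f σ ≤ cost n p q g σ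
    j-first a<b = sumF-mono₂ n a≢b
      (λ i i≢a i≢b → cong (λ k → weight n i * (p (s i) + q (f k))) (sym (t-fixes i i≢a i≢b)))
      (subst₂ _≤_ (sym (cong₂ _+_ (cong (λ k → weight n a * jobCost f k) s-a)
                                 (cong (λ k → weight n b * jobCost f k) s-b)))
                  (sym (cong₂ _+_ g-at-a g-at-b))
                  (exchangeʳ (p j) (p l) (weight-antitone n (ℕ.<⇒≤ a<b)) qfj≤qfl))

    l-first : b F.< a → cost n p q f (σ ∘ₚ transpose j l) ≤ cost n p q g σ
    l-first b<a = sumF-mono₂ n (a≢b ∘′ sym)
      (λ i i≢b i≢a → cong (λ k → weight n i * (p k + q (g (s i)))) (t-fixes i i≢a i≢b))
      (subst₂ _≤_ (sym (cong₂ _+_ (f-after-t b s-b (transpose-matchʳ j l))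
                                 (f-after-t a s-a (transpose-matchˡ j l))))
                  (sym (cong₂ _+_ g-at-b g-at-a))
                  (exchangeˡ (q (f j)) (q (f l)) (weight-antitone n (ℕ.<⇒≤ b<a)) pj≤pl))
      where
      f-after-t : ∀ x {k k′} → s x ≡ k → t k ≡ k′ →
                  weight n x * jobCost f (t (s x)) ≡ weight n x * jobCost f k′
      f-after-t x sx≡k tk≡k′ = cong (λ k → weight n x * jobCost f k) (trans (cong t sx≡k) tk≡k′)

  ≼-transpose : ∀ f {j l} → j ≢ l → p j ≤ p l → q (f j) ≤ q (f l) → f ≼ f ∘′ PC.transpose j l
  ≼-transpose f {j} {l} j≢l pj≤pl qfj≤qfl = improve improve-at
    where
    improve-at : ∀ σ → ∃ λ τ → cost n p q f τ ≤ cost n p q (f ∘′ PC.transpose j l) σ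
    improve-at σ with F.<-cmp (σ ⟨$⟩ˡ j) (σ ⟨$⟩ˡ l)
    ... | tri< a<b _ _ = σ , j-first a<b
      where open Exchange f j≢l pj≤pl qfj≤qfl σ
    ... | tri≈ _ a≡b _ = contradiction a≡b (Exchange.a≢b f j≢l pj≤pl qfj≤qfl σ)
    ... | tri> _ _ b<a = σ ∘ₚ transpose j l , l-first b<a
      where open Exchange f j≢l pj≤pl qfj≤qfl σ

  module _ (p-mono : ∀ i j → i F.≤ j → p i ≤ p j) (q-mono : ∀ i j → i F.≤ j → q i ≤ q j) where

    extend-agreement : ∀ (π : Permutation′ n) K → AgreesBelow π (F.toℕ K) →
                       ∃ λ π′ → AgreesBelow π′ (ℕ.suc (F.toℕ K)) × (π ⟨$⟩ʳ_) ≼ (π′ ⟨$⟩ʳ_)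
    extend-agreement π K agree with π ⟨$⟩ʳ K F.≟ opposite K
    ... | yes πK≡ = π , agreesBelow-suc π K agree πK≡ , ≼-refl
    ... | no  πK≢ = transpose K l ∘ₚ π , agreesBelow-suc (transpose K l ∘ₚ π) K agree′ π′K≡ ,
                    ≼-transpose (π ⟨$⟩ʳ_) (F.<⇒≢ K<l) (p-mono K l (ℕ.<⇒≤ K<l)) qπK≤qπl
      where
      l : Fin n
      l = π ⟨$⟩ˡ opposite K
      πl≡ : π ⟨$⟩ʳ l ≡ opposite K
      πl≡ = inverseʳ π
      K<l : K F.< l
      K<l = F.≤∧≢⇒< (ℕ.≮⇒≥ λ l<K → F.<⇒≢ (opposite-antimono-< l<K) (trans (sym πl≡) (agree l l<K)))
                     (λ K≡l → πK≢ (trans (cong (π ⟨$⟩ʳ_) K≡l) πl≡))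
      qπK≤qπl : q (π ⟨$⟩ʳ K) ≤ q (π ⟨$⟩ʳ l)
      qπK≤qπl = q-mono _ _ (subst (π ⟨$⟩ʳ K F.≤_) (sym πl≡) (agreesBelow-bound π K agree))
      agree′ : AgreesBelow (transpose K l ∘ₚ π) (F.toℕ K)
      agree′ i i<K = trans (cong (π ⟨$⟩ʳ_) (transpose-other (F.<⇒≢ i<K) (F.<⇒≢ (ℕ.<-trans i<K K<l))))
                           (agree i i<K)
      π′K≡ : π ⟨$⟩ʳ PC.transpose K l K ≡ opposite K
      π′K≡ = trans (cong (π ⟨$⟩ʳ_) (transpose-matchˡ K l)) πl≡

    ≼-agreeing : ∀ k → k ℕ.≤ n → (π : Permutation′ n) → ∃ λ π′ → AgreesBelow π′ k × (π ⟨$⟩ʳ_) ≼ (π′ ⟨$⟩ʳ_)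
    ≼-agreeing ℕ.zero    _   π = π , (λ _ ()) , ≼-refl
    ≼-agreeing (ℕ.suc k) k<n π with ≼-agreeing k (ℕ.<⇒≤ k<n) π | F.fromℕ< k<n | F.toℕ-fromℕ< k<n
    ... | π′ , agree′ , π≼π′ | K | refl with extend-agreement π′ K agree′
    ...   | π″ , agree″ , π′≼π″ = π″ , agree″ , ≼-trans π≼π′ π′≼π″

    ≼-opposite : (π : Permutation′ n) → (π ⟨$⟩ʳ_) ≼ opposite
    ≼-opposite π with ≼-agreeing n ℕ.≤-refl π
    ... | π′ , agree , π≼π′ = ≼-trans π≼π′ (≗⇒≼ λ i → agree i (F.toℕ<n i))

lemma1 : (n : ℕ) → n ≥ 1 → (p q : Fin n → ℚ)
    → (∀ i → 0ℚ ≤ p i) → (∀ i j → i Data.Fin.≤ j → p i ≤ p j)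
    → (∀ i → 0ℚ ≤ q i) → (∀ i j → i Data.Fin.≤ j → q i ≤ q j)
    → (π : Permutation′ n) → (u u′ : ℚ)
    → IsUB n p q (π ⟨$⟩ʳ_) u → IsUB n p q opposite u′
    → (h : 0ℚ < LB n p q)
    → _÷_ u (LB n p q) {{pos⇒nonZero (LB n p q) {{positive h}}}} ≤ _÷_ u′ (LB n p q) {{pos⇒nonZero (LB n p q) {{positive h}}}}
lemma1 n _ p q _ p-mono _ q-mono π u u′ UB-π UB-opposite LB>0 =
  ÷-monoˡ-≤-pos (LB n p q) {{positive LB>0}} (IsUB-mono (≼-opposite p-mono q-mono π) UB-π UB-opposite)
  where open Schedules p q
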